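{- Let $n,p>0$ be integers and let $\mathbf{A}=\langle A;\odot,\multimap,\wedge,\vee,\bot,\top\rangle$ with $A=A^{p+1}_{n+1}$ be as in the context. Then: $\langle A;\odot,\top\rangle$ is a commutative monoid; $\langle A;\vee,\wedge,\bot,\top\rangle$ is a bounded distributive lattice with least element $\bot=\langle(n,0),0\rangle$ and greatest element $\top=\langle(n,0),p\rangle$; and for all $a,b,c\in A$, $a\odot b\le c$ if and only if $a\le b\multimap c$, where $\le$ is the lattice order. Moreover $\mathbf{A}$ is involutive: for every $a\in A$, $(a\multimap\bot)\multimap\bot=a$.
   Context: Fix integers $n,p>0$. On $\mathbb{Z}\times\mathbb{Z}$ use componentwise addition/subtraction and the lexicographic total order $\preccurlyeq$: $(m,r)\preccurlyeq(k,s)$ iff $m<k$, or $m=k$ and $r\le s$; $\max,\min$ are taken with respect to $\preccurlyeq$. For an integer $j\ge 0$ let $L^\omega_{j+1}=\{(m,r)\in\mathbb{Z}^2:(0,0)\preccurlyeq(m,r)\preccurlyeq(j,0)\}$. On $L^\omega_{n+1}$ put $x*y=\max\{(0,0),x+y-(n,0)\}$ and $x\to y=\min\{(n,0),(n,0)-x+y\}$. Let $L_{p+1}=\{0,1,\dots,p\}$ with the usual order and $\alpha*\beta=\max\{0,\alpha+\beta-p\}$. Let $A=A^{p+1}_{n+1}=(L^\omega_{n+1}\times\{0,p\})\cup(L^\omega_{n}\times\{1,\dots,p-1\})$, with elements written $\langle(m,r),\alpha\rangle$. Define $\langle(m,r),\alpha\rangle\le\langle(k,s),\beta\rangle$ iff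 either (o1) $0<\alpha\le\beta$ and $(m,r)\preccurlyeq(k,s)$; or (o2) $\alpha=\beta=0$ and $(k,s)\preccurlyeq(m,r)$; or (o3) $\alpha=0<\beta$ and $(n-1,0)\preccurlyeq(m+k,r+s)$; $\wedge,\vee$ denote meet and join for $\le$. Define the commutative operation $\odot$ on $A$, for $a=\langle(m,r),\alpha\rangle$, $b=\langle(k,s),\beta\rangle$: (i) if $\alpha,\beta>0$ and $\alpha*\beta\neq0$: $a\odot b=\langle(m,r)*(k,s),\alpha*\beta\rangle$; (ii) if $\alpha,\beta>0$ and $\alpha*\beta=0$: $a\odot b=\langle\min\{(n,0),(2n-(m+k+1),-(r+s))\},0\rangle$; (iii) if $\alpha>0$, $\beta=0$: $a\odot b=b\odot a=\langle(m,r)\to(k,s),0\rangle$; (iv) if $\alpha=\beta=0$: $a\odot b=\langle\min\{(n,0),(m+k+1,r+s)\},0\rangle$. Define $\sim\langle(m,r),\alpha\rangle=\langle(m,r),p-\alpha\rangle$ if $\alpha\in\{0,p\}$, and $\sim\langle(m,r),\alpha\rangle=\langle(n-1-m,-r),p-\alpha\rangle$ if $\alpha\notin\{0,p\}$. Define $x\multimap y=\sim(x\odot\sim y)$. -}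

module Defs where

open import Data.Nat as ℕ using (ℕ; zero; suc; _∸_)
open import Data.Integer as ℤ using (ℤ; +_; _<?_; _≤?_)
open import Data.Product using (_×_; _,_)
open import Data.Sum using (_⊎_)
open import Data.Bool using (if_then_else_)
open import Relation.Nullary using (Dec; yes; no)
open import Relation.Nullary.Decidable using (⌊_⌋; _⊎-dec_; _×-dec_)
open import Relation.Binary.PropositionalEquality using (_≡_)

ℤ² : Set
ℤ² = ℤ × ℤ

_≼_ : ℤ² → ℤ² → Set
(m , r) ≼ (k , s) = (m ℤ.< k) ⊎ ((m ≡ k) × (r ℤ.≤ s))

_≼?_ : (x y : ℤ²) → Dec (x ≼ y)
(m , r) ≼? (k , s) = (m <? k) ⊎-dec ((m ℤ.≟ k) ×-dec (r ≤? s))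

maxL : ℤ² → ℤ² → ℤ²
maxL x y = if ⌊ x ≼? y ⌋ then y else x

minL : ℤ² → ℤ² → ℤ²
minL x y = if ⌊ x ≼? y ⌋ then x else y

-- L^ω_{j+1} membership, given the upper bound (j , 0)
InL : ℤ → ℤ² → Set
InL j x = ((+ 0 , + 0) ≼ x) × (x ≼ (j , + 0))

Raw : Set
Raw = ℤ² × ℕ

module Alg (n p : ℕ) where

  N : ℤ
  N = + n

  nn : ℤ²
  nn = (N , + 0)

  n-1 : ℤ
  n-1 = N ℤ.- + 1

  _*L_ : ℤ² → ℤ² → ℤ²
  (m , r) *L (k , s) = maxL (+ 0 , + 0) ((m ℤ.+ k) ℤ.- N , r ℤ.+ s)

  _→L_ : ℤ² → ℤ² → ℤ²
  (m , r) →L (k , s) = minL nn ((N ℤ.- m) ℤ.+ k , (ℤ.- r) ℤ.+ s)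

  _*p_ : ℕ → ℕ → ℕ
  α *p β = (α ℕ.+ β) ∸ p

  data InA : Raw → Set where
    end0 : ∀ {x} → InL N x → InA (x , 0)
    endp : ∀ {x} → InL N x → InA (x , p)
    mid  : ∀ {x α} → 0 ℕ.< α → α ℕ.< p → InL n-1 x → InA (x , α)

  data _⊑_ : Raw → Raw → Set where
    o1 : ∀ {x y α β} → 0 ℕ.< α → α ℕ.≤ β → x ≼ y → (x , α) ⊑ (y , β)
    o2 : ∀ {x y} → y ≼ x → (x , 0) ⊑ (y , 0)
    o3 : ∀ {m r k s β} → 0 ℕ.< β → (n-1 , + 0) ≼ (m ℤ.+ k , r ℤ.+ s)
       → ((m , r) , 0) ⊑ ((k , s) , β)

  case-ii : ℤ² → ℤ² → Raw
  case-ii (m , r) (k , s) =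
    (minL nn ((+ 2 ℤ.* N) ℤ.- ((m ℤ.+ k) ℤ.+ + 1) , ℤ.- (r ℤ.+ s)) , 0)

  _⊙_ : Raw → Raw → Raw
  (x , suc a) ⊙ (y , suc b) with suc a *p suc b
  ... | zero  = case-ii x y
  ... | suc c = (x *L y , suc c)
  (x , suc a) ⊙ (y , zero)  = (x →L y , 0)
  (x , zero)  ⊙ (y , suc b) = (y →L x , 0)
  ((m , r) , zero) ⊙ ((k , s) , zero) =
    (minL nn ((m ℤ.+ k) ℤ.+ + 1 , r ℤ.+ s) , 0)

  ∼ : Raw → Raw
  ∼ ((m , r) , α) with α ℕ.≟ 0 | α ℕ.≟ p
  ... | yes _ | _     = ((m , r) , p ∸ α)
  ... | no _  | yes _ = ((m , r) , p ∸ α)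
  ... | no _  | no _  = ((n-1 ℤ.- m , ℤ.- r) , p ∸ α)

  _⊸_ : Raw → Raw → Raw
  x ⊸ y = ∼ (x ⊙ ∼ y)

  ⊥A : Raw
  ⊥A = (nn , 0)

  ⊤A : Raw
  ⊤A = (nn , p)

{-# OPTIONS --safe #-}

-- Let φ fix ⟨x , α⟩ for α > 0 and send ⟨x , 0⟩ to ⟨(n-1 , 0) − x , 0⟩.  This involution maps A onto the
-- pairs (u , α) with α ≤ p and lower α ≼ u ≼ upper α, where lower α is (−1 , 0) for α = 0 and (0 , 0)
-- otherwise, and upper α is (n , 0) for α = p and (n-1 , 0) otherwise; it turns (o1)–(o3) into the
-- componentwise order ≼ × ≤.  In these coordinates
--   φ (a ⊙ b) = (max (lower (α * β)) (u + v − (n , 0)) , α * β)   and   φ (∼ a) = ((n-1 , 0) − u , p − α),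
-- so the monoid laws and involutivity become computations with a truncated translation-invariant
-- operation, and the lattice is a product of two chains, hence distributive.  Residuation follows from
-- associativity, ∼ ∼ a = a and the fact that a ⊙ ∼ b = ⊥ exactly when a ≤ b: in coordinates both say
-- u + ((n-1 , 0) − v) − (n , 0) ≼ (−1 , 0) and α ≤ β.

module Submission where

open import Defs
open import Data.Nat using (ℕ; _<_)
open import Data.Product using (_×_; Σ)
open import Relation.Binary.PropositionalEquality using (_≡_)

open import Algebra.Construct.NaturalChoice.Base using (MinOperator; MaxOperator)
import Algebra.Construct.NaturalChoice.MinMaxOp as MinMaxOp
open import Data.Empty using (⊥-elim)
open import Data.Integer as ℤ using (ℤ; +_; 0ℤ; -1ℤ; _+_; _-_; -_; _*_)
import Data.Integer.Properties as ℤP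
open import Data.Integer.Tactic.RingSolver using (solve-∀)
import Data.Nat as ℕ
open import Data.Nat using (zero; suc; _∸_; z≤n; s≤s)
import Data.Nat.Properties as ℕP
open import Data.Product using (_,_; proj₁; proj₂; map)
open import Data.Product.Relation.Binary.Pointwise.NonDependent using (Pointwise; ≡×≡⇒≡)
import Data.Product.Relation.Binary.Lex.Strict as Lex
open import Data.Sum using (inj₁; inj₂; [_,_]′)
open import Function using (_∘_; case_of_)
open import Relation.Binary.Bundles using (TotalPreorder)
open import Relation.Binary.Definitions
  using (Reflexive; Transitive; Antisymmetric; Total; Monotonic₁; Antitonic₁)
open import Relation.Binary.PropositionalEquality as ≡
  using (refl; sym; trans; cong; cong₂; subst; subst₂; _≢_; module ≡-Reasoning)
import Relation.Binary.Reasoning.Preorder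
open import Relation.Binary.Structures using (IsTotalPreorder)
open import Relation.Nullary.Decidable using (Dec; yes; no)

≼-refl : Reflexive _≼_
≼-refl = inj₂ (refl , ℤP.≤-refl)

≼-trans : Transitive _≼_
≼-trans = Lex.×-transitive {_<₁_ = ℤ._<_} {_<₂_ = ℤ._≤_} ≡.isEquivalence (≡.resp₂ ℤ._<_) ℤP.<-trans ℤP.≤-trans

≼-antisym : Antisymmetric _≡_ _≼_
≼-antisym x≼y y≼x =
  ≡×≡⇒≡ (Lex.×-antisymmetric {_<₁_ = ℤ._<_} {_<₂_ = ℤ._≤_} sym ℤP.<-irrefl ℤP.<-asym ℤP.≤-antisym x≼y y≼x)

≼-total : Total _≼_
≼-total = Lex.×-total₂ {_<₁_ = ℤ._<_} {_<₂_ = ℤ._≤_} sym ℤP.<-cmp ℤP.≤-total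

≼-isTotalPreorder : IsTotalPreorder _≡_ _≼_
≼-isTotalPreorder = record
  { isPreorder = record
    { isEquivalence = ≡.isEquivalence
    ; reflexive     = λ { refl → ≼-refl }
    ; trans         = ≼-trans
    }
  ; total = ≼-total
  }

≼-totalPreorder : TotalPreorder _ _ _
≼-totalPreorder = record { isTotalPreorder = ≼-isTotalPreorder }

module ≼-Reasoning = Relation.Binary.Reasoning.Preorder (TotalPreorder.preorder ≼-totalPreorder)

minL-≼ : ∀ {x y} → x ≼ y → minL x y ≡ x
minL-≼ {x} {y} x≼y with x ≼? y
... | yes _   = refl
... | no x⋠y = ⊥-elim (x⋠y x≼y)

minL-≽ : ∀ {x y} → y ≼ x → minL x y ≡ y
minL-≽ {x} {y} y≼x with x ≼? y
... | yes x≼y = ≼-antisym x≼y y≼x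
... | no _    = refl

maxL-≼ : ∀ {x y} → x ≼ y → maxL x y ≡ y
maxL-≼ {x} {y} x≼y with x ≼? y
... | yes _   = refl
... | no x⋠y = ⊥-elim (x⋠y x≼y)

maxL-≽ : ∀ {x y} → y ≼ x → maxL x y ≡ x
maxL-≽ {x} {y} y≼x with x ≼? y
... | yes x≼y = ≼-antisym y≼x x≼y
... | no _    = refl

minL-minOperator : MinOperator ≼-totalPreorder
minL-minOperator = record { _⊓_ = minL ; x≤y⇒x⊓y≈x = minL-≼ ; x≥y⇒x⊓y≈y = minL-≽ }

maxL-maxOperator : MaxOperator ≼-totalPreorder
maxL-maxOperator = record { _⊔_ = maxL ; x≤y⇒x⊔y≈y = maxL-≼ ; x≥y⇒x⊔y≈x = maxL-≽ }

open MinMaxOp minL-minOperator maxL-maxOperator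
  using ( x⊓y≤x; x⊓y≤y; ⊓-glb; x≤x⊔y; x≤y⊔x; ⊔-lub; ⊔-assoc; ⊓-distribˡ-⊔
        ; mono-≤-distrib-⊔; antimono-≤-distrib-⊓ )

maxL-absorb : ∀ {x y} z → x ≼ y → maxL y (maxL x z) ≡ maxL y z
maxL-absorb {x} {y} z x≼y = trans (sym (⊔-assoc y x z)) (cong (λ t → maxL t z) (maxL-≽ x≼y))

≤⇒≼ : ∀ {m r k s} → m ℤ.≤ k → r ℤ.≤ s → (m , r) ≼ (k , s)
≤⇒≼ {m} {k = k} m≤k r≤s with m ℤ.≟ k
... | yes refl = inj₂ (refl , r≤s)
... | no m≢k   = inj₁ (ℤP.≤∧≢⇒< m≤k m≢k)

≼-map : ∀ {f g : ℤ → ℤ} → Monotonic₁ ℤ._<_ ℤ._<_ f → Monotonic₁ ℤ._≤_ ℤ._≤_ g →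
        ∀ {x y} → x ≼ y → map f g x ≼ map f g y
≼-map f-mono g-mono {m , r} {k , s} (inj₁ m<k)          = inj₁ (f-mono m<k)
≼-map f-mono g-mono {m , r} {.m , s} (inj₂ (refl , r≤s)) = inj₂ (refl , g-mono r≤s)

≼-map-antitone : ∀ {f g : ℤ → ℤ} → Antitonic₁ ℤ._<_ ℤ._<_ f → Antitonic₁ ℤ._≤_ ℤ._≤_ g →
                 ∀ {x y} → x ≼ y → map f g y ≼ map f g x
≼-map-antitone f-anti g-anti {m , r} {k , s} (inj₁ m<k)          = inj₁ (f-anti m<k)
≼-map-antitone f-anti g-anti {m , r} {.m , s} (inj₂ (refl , r≤s)) = inj₂ (refl , g-anti r≤s)

≼-translate : ∀ (d e : ℤ) {x y} → x ≼ y → map (_+ d) (_+ e) x ≼ map (_+ d) (_+ e) y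
≼-translate d e = ≼-map (ℤP.+-monoˡ-< d) (ℤP.+-monoˡ-≤ e)

axis : ℤ → ℤ²
axis m = (m , + 0)

module Model (n p : ℕ) (n>0 : 0 < n) (p>0 : 0 < p) where
  open Alg n p

  -- Reflection and shifted addition on ℤ²

  mirror : ℤ² → ℤ²
  mirror (m , r) = (n-1 - m , - r)

  mirror-involutive : ∀ x → mirror (mirror x) ≡ x
  mirror-involutive (m , r) = cong₂ _,_ (c-[c-m]≡m n-1 m) (ℤP.neg-involutive r)
    where c-[c-m]≡m : ∀ c m → c - (c - m) ≡ m
          c-[c-m]≡m = solve-∀

  mirror-antitone : ∀ {x y} → x ≼ y → mirror y ≼ mirror x
  mirror-antitone = ≼-map-antitone (λ a<b → ℤP.+-monoʳ-< n-1 (ℤP.neg-mono-< a<b)) ℤP.neg-mono-≤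

  mirror-reflects : ∀ {x y} → mirror x ≼ mirror y → y ≼ x
  mirror-reflects {x} {y} h = subst₂ _≼_ (mirror-involutive y) (mirror-involutive x) (mirror-antitone h)

  mirror-n : mirror nn ≡ axis -1ℤ
  mirror-n = cong axis ([N-1]-N≡-1 N)
    where [N-1]-N≡-1 : ∀ N → (N - + 1) - N ≡ -1ℤ
          [N-1]-N≡-1 = solve-∀

  mirror-0 : mirror (axis 0ℤ) ≡ axis n-1
  mirror-0 = cong axis (ℤP.+-identityʳ n-1)

  mirror-₋1 : mirror (axis -1ℤ) ≡ nn
  mirror-₋1 = trans (cong mirror (sym mirror-n)) (mirror-involutive nn)

  mirror-minL-n : ∀ x → mirror (minL nn x) ≡ maxL (axis -1ℤ) (mirror x)
  mirror-minL-n x = trans (antimono-≤-distrib-⊓ (cong mirror) mirror-antitone nn x)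
                          (cong (λ t → maxL t (mirror x)) mirror-n)

  -1≼0 : axis -1ℤ ≼ axis 0ℤ
  -1≼0 = inj₁ ℤ.-<+

  0≼n-1 : axis 0ℤ ≼ axis n-1
  0≼n-1 = ≤⇒≼ (ℤP.i≤j⇒0≤j-i (ℤ.+≤+ n>0)) ℤP.≤-refl

  n-1≼n : axis n-1 ≼ nn
  n-1≼n = ≤⇒≼ (ℤP.i-j≤i N (+ 1)) ℤP.≤-refl

  0≼n : axis 0ℤ ≼ nn
  0≼n = ≼-trans 0≼n-1 n-1≼n

  -- Defs leaves _≼_ at the default fixity 20.
  infixl 30 _⊞_
  _⊞_ : ℤ² → ℤ² → ℤ²
  (m , r) ⊞ (k , s) = ((m + k) - N , r + s)

  ⊞-comm : ∀ x y → x ⊞ y ≡ y ⊞ x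
  ⊞-comm (m , r) (k , s) = cong₂ _,_ (cong (_- N) (ℤP.+-comm m k)) (ℤP.+-comm r s)

  ⊞-assoc : ∀ x y z → (x ⊞ y) ⊞ z ≡ x ⊞ (y ⊞ z)
  ⊞-assoc (m , r) (k , s) (l , t) = cong₂ _,_ ([m+k-N+l]-N≡[m+[k+l-N]]-N N m k l) (ℤP.+-assoc r s t)
    where [m+k-N+l]-N≡[m+[k+l-N]]-N : ∀ N m k l → ((m + k) - N + l) - N ≡ (m + ((k + l) - N)) - N
          [m+k-N+l]-N≡[m+[k+l-N]]-N = solve-∀

  ⊞-identityˡ : ∀ x → nn ⊞ x ≡ x
  ⊞-identityˡ (m , r) = cong₂ _,_ ([N+m]-N≡m N m) (ℤP.+-identityˡ r)
    where [N+m]-N≡m : ∀ N m → (N + m) - N ≡ m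
          [N+m]-N≡m = solve-∀

  ⊞-identityʳ : ∀ x → x ⊞ nn ≡ x
  ⊞-identityʳ x = trans (⊞-comm x nn) (⊞-identityˡ x)

  0⊞n-1 : axis 0ℤ ⊞ axis n-1 ≡ axis -1ℤ
  0⊞n-1 = cong axis ([0+[N-1]]-N≡-1 N)
    where [0+[N-1]]-N≡-1 : ∀ N → (+ 0 + (N - + 1)) - N ≡ -1ℤ
          [0+[N-1]]-N≡-1 = solve-∀

  ⊞-monoˡ : ∀ z {x y} → x ≼ y → x ⊞ z ≼ y ⊞ z
  ⊞-monoˡ (k , s) = ≼-map (λ a<b → ℤP.+-monoˡ-< (- N) (ℤP.+-monoˡ-< k a<b)) (ℤP.+-monoˡ-≤ s)

  ⊞-monoʳ : ∀ x {y z} → y ≼ z → x ⊞ y ≼ x ⊞ z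
  ⊞-monoʳ x {y} {z} h = subst₂ _≼_ (⊞-comm y x) (⊞-comm z x) (⊞-monoˡ x h)

  ⊞-mono : ∀ {x x′ y y′} → x ≼ x′ → y ≼ y′ → x ⊞ y ≼ x′ ⊞ y′
  ⊞-mono {x′ = x′} {y} x≼x′ y≼y′ = ≼-trans (⊞-monoˡ y x≼x′) (⊞-monoʳ x′ y≼y′)

  mirror≼⇒n-1≼+ : ∀ {m r k s} → mirror (m , r) ≼ (k , s) → axis n-1 ≼ (m + k , r + s)
  mirror≼⇒n-1≼+ {m} {r} {k} {s} h =
    subst₂ _≼_ (cong₂ _,_ (c-m+m≡c n-1 m) (ℤP.+-inverseˡ r)) (cong₂ _,_ (ℤP.+-comm k m) (ℤP.+-comm s r))
           (≼-translate m r h)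
    where c-m+m≡c : ∀ c m → c - m + m ≡ c
          c-m+m≡c = solve-∀

  n-1≼+⇒mirror≼ : ∀ {m r k s} → axis n-1 ≼ (m + k , r + s) → mirror (m , r) ≼ (k , s)
  n-1≼+⇒mirror≼ {m} {r} {k} {s} h =
    subst₂ _≼_ (cong (n-1 - m ,_) (ℤP.+-identityˡ (- r))) (cong₂ _,_ (m+k-m≡k m k) (m+k-m≡k r s))
           (≼-translate (- m) (- r) h)
    where m+k-m≡k : ∀ m k → m + k - m ≡ k
          m+k-m≡k = solve-∀

  ≼⇒⊞mirror≼-1 : ∀ {x y} → x ≼ y → x ⊞ mirror y ≼ axis -1ℤ
  ≼⇒⊞mirror≼-1 {m , r} {k , s} h =
    subst₂ _≼_ (cong (_, r - s) (m+[c-N]≡[m+c]-N N m (n-1 - k)))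
               (cong₂ _,_ (k+[N-1-k-N]≡-1 N k) (ℤP.+-inverseʳ s))
           (≼-translate (n-1 - k - N) (- s) h)
    where m+[c-N]≡[m+c]-N : ∀ N m c → m + (c - N) ≡ (m + c) - N
          m+[c-N]≡[m+c]-N = solve-∀
          k+[N-1-k-N]≡-1 : ∀ N k → k + ((N - + 1) - k - N) ≡ -1ℤ
          k+[N-1-k-N]≡-1 = solve-∀

  ⊞mirror≼-1⇒≼ : ∀ {x y} → x ⊞ mirror y ≼ axis -1ℤ → x ≼ y
  ⊞mirror≼-1⇒≼ {m , r} {k , s} h =
    subst₂ _≼_ (cong₂ _,_ ([m+[N-1-k]]-N+[k+1]≡m N m k) (r-s+s≡r r s))
               (cong₂ _,_ (-1+[k+1]≡k k) (ℤP.+-identityˡ s))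
           (≼-translate (k + + 1) s h)
    where [m+[N-1-k]]-N+[k+1]≡m : ∀ N m k → (m + ((N - + 1) - k)) - N + (k + + 1) ≡ m
          [m+[N-1-k]]-N+[k+1]≡m = solve-∀
          r-s+s≡r : ∀ r s → r - s + s ≡ r
          r-s+s≡r = solve-∀
          -1+[k+1]≡k : ∀ k → -1ℤ + (k + + 1) ≡ k
          -1+[k+1]≡k = solve-∀

  -- The truncated sum on {0, …, p}

  *p-comm : ∀ α β → α *p β ≡ β *p α
  *p-comm α β = cong (_∸ p) (ℕP.+-comm α β)

  *p-identityˡ : ∀ α → p *p α ≡ α
  *p-identityˡ = ℕP.m+n∸m≡n p

  *p-identityʳ : ∀ α → α *p p ≡ α
  *p-identityʳ α = ℕP.m+n∸n≡m α p

  *p-zeroˡ : ∀ {β} → β ℕ.≤ p → 0 *p β ≡ 0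
  *p-zeroˡ = ℕP.m≤n⇒m∸n≡0

  *p-zeroʳ : ∀ {α} → α ℕ.≤ p → α *p 0 ≡ 0
  *p-zeroʳ {α} α≤p = trans (*p-comm α 0) (*p-zeroˡ α≤p)

  *p≤ˡ : ∀ α {β} → β ℕ.≤ p → α *p β ℕ.≤ α
  *p≤ˡ α {β} β≤p = ℕP.≤-trans (ℕP.∸-monoˡ-≤ p (ℕP.+-monoʳ-≤ α β≤p)) (ℕP.≤-reflexive (ℕP.m+n∸n≡m α p))

  *p≤p : ∀ {α β} → α ℕ.≤ p → β ℕ.≤ p → α *p β ℕ.≤ p
  *p≤p {α} α≤p β≤p = ℕP.≤-trans (*p≤ˡ α β≤p) α≤p

  *p-assoc : ∀ α β γ → α ℕ.≤ p → γ ℕ.≤ p → (α *p β) *p γ ≡ α *p (β *p γ)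
  *p-assoc α β γ α≤p γ≤p = begin
      ((α ℕ.+ β) ∸ p ℕ.+ γ) ∸ p   ≡⟨ [a∸p+γ]∸p γ≤p ⟩
      (α ℕ.+ β ℕ.+ γ) ∸ (p ℕ.+ p) ≡⟨ cong (_∸ (p ℕ.+ p)) (ℕP.+-assoc α β γ) ⟩
      (α ℕ.+ (β ℕ.+ γ)) ∸ (p ℕ.+ p) ≡⟨ cong (_∸ (p ℕ.+ p)) (ℕP.+-comm α (β ℕ.+ γ)) ⟩
      (β ℕ.+ γ ℕ.+ α) ∸ (p ℕ.+ p) ≡⟨ [a∸p+γ]∸p α≤p ⟨
      ((β ℕ.+ γ) ∸ p ℕ.+ α) ∸ p   ≡⟨ *p-comm ((β ℕ.+ γ) ∸ p) α ⟩
      α *p (β *p γ)               ∎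
    where
      open ≡-Reasoning
      [a∸p+γ]∸p : ∀ {a γ} → γ ℕ.≤ p → (a ∸ p ℕ.+ γ) ∸ p ≡ (a ℕ.+ γ) ∸ (p ℕ.+ p)
      [a∸p+γ]∸p {a} {γ} γ≤p with ℕP.≤-total p a
      ... | inj₁ p≤a = trans (cong (_∸ p) (sym (ℕP.+-∸-comm γ p≤a))) (ℕP.∸-+-assoc (a ℕ.+ γ) p p)
      ... | inj₂ a≤p = begin
        (a ∸ p ℕ.+ γ) ∸ p     ≡⟨ cong (λ t → (t ℕ.+ γ) ∸ p) (ℕP.m≤n⇒m∸n≡0 a≤p) ⟩
        γ ∸ p                 ≡⟨ ℕP.m≤n⇒m∸n≡0 γ≤p ⟩
        0                     ≡⟨ ℕP.m≤n⇒m∸n≡0 (ℕP.+-mono-≤ a≤p γ≤p) ⟨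
        (a ℕ.+ γ) ∸ (p ℕ.+ p) ∎

  *p-complement : ∀ α {β} → β ℕ.≤ p → α *p (p ∸ β) ≡ α ∸ β
  *p-complement α {β} β≤p = begin
    (α ℕ.+ (p ∸ β)) ∸ p   ≡⟨ cong (_∸ p) (ℕP.+-∸-assoc α β≤p) ⟨
    (α ℕ.+ p) ∸ β ∸ p     ≡⟨ ℕP.∸-+-assoc (α ℕ.+ p) β p ⟩
    (α ℕ.+ p) ∸ (β ℕ.+ p) ≡⟨ cong₂ _∸_ (ℕP.+-comm α p) (ℕP.+-comm β p) ⟩
    (p ℕ.+ α) ∸ (p ℕ.+ β) ≡⟨ ℕP.[m+n]∸[m+o]≡n∸o p α β ⟩
    α ∸ β                 ∎
    where open ≡-Reasoning

  -- Bounds on the first coordinate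

  lower : ℕ → ℤ²
  lower zero    = axis -1ℤ
  lower (suc _) = axis 0ℤ

  upper : ℕ → ℤ²
  upper α with α ℕ.≟ p
  ... | yes _ = nn
  ... | no _  = axis n-1

  lower-pos : ∀ {α} → 0 < α → lower α ≡ axis 0ℤ
  lower-pos {suc _} _ = refl

  upper-≡p : ∀ {α} → α ≡ p → upper α ≡ nn
  upper-≡p {α} α≡p with α ℕ.≟ p
  ... | yes _   = refl
  ... | no α≢p = ⊥-elim (α≢p α≡p)

  upper-p : upper p ≡ nn
  upper-p = upper-≡p refl

  upper-≢p : ∀ {α} → α ≢ p → upper α ≡ axis n-1
  upper-≢p {α} α≢p with α ℕ.≟ p
  ... | yes α≡p = ⊥-elim (α≢p α≡p)
  ... | no _    = refl

  -1≼lower : ∀ α → axis -1ℤ ≼ lower α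
  -1≼lower zero    = ≼-refl
  -1≼lower (suc _) = -1≼0

  lower≼0 : ∀ α → lower α ≼ axis 0ℤ
  lower≼0 zero    = -1≼0
  lower≼0 (suc _) = ≼-refl

  n-1≼upper : ∀ α → axis n-1 ≼ upper α
  n-1≼upper α with α ℕ.≟ p
  ... | yes _ = n-1≼n
  ... | no _  = ≼-refl

  upper≼n : ∀ α → upper α ≼ nn
  upper≼n α with α ℕ.≟ p
  ... | yes _ = ≼-refl
  ... | no _  = n-1≼n

  lower≼upper : ∀ α → lower α ≼ upper α
  lower≼upper α = ≼-trans (lower≼0 α) (≼-trans 0≼n-1 (n-1≼upper α))

  lower-mono : ∀ {α β} → α ℕ.≤ β → lower α ≼ lower β
  lower-mono {zero}  {β}     _ = -1≼lower β
  lower-mono {suc _} {suc _} _ = ≼-refl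

  upper-mono : ∀ {α β} → α ℕ.≤ β → β ℕ.≤ p → upper α ≼ upper β
  upper-mono {α} {β} α≤β β≤p with β ℕ.≟ p
  ... | yes refl = upper≼n α
  ... | no β≢p   = subst (_≼ axis n-1) (sym (upper-≢p α≢p)) ≼-refl
    where α≢p : α ≢ p
          α≢p refl = β≢p (ℕP.≤-antisym β≤p α≤β)

  upper-0 : upper 0 ≡ axis n-1
  upper-0 = upper-≢p (ℕP.<⇒≢ p>0)

  upper-complement : ∀ {α} → α ℕ.≤ p → upper (p ∸ α) ≡ mirror (lower α)
  upper-complement {zero}  _   = trans upper-p (sym mirror-₋1)
  upper-complement {suc α} α<p = trans (upper-≢p p∸α≢p) (sym mirror-0)
    where p∸α≢p : p ∸ suc α ≢ p
          p∸α≢p e = ℕP.<-irrefl e (ℕP.∸-monoʳ-< (s≤s z≤n) α<p)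

  lower-complement : ∀ {α} → α ℕ.≤ p → lower (p ∸ α) ≡ mirror (upper α)
  lower-complement {α} α≤p = begin
    lower (p ∸ α)                         ≡⟨ mirror-involutive (lower (p ∸ α)) ⟨
    mirror (mirror (lower (p ∸ α)))       ≡⟨ cong mirror (upper-complement (ℕP.m∸n≤m p α)) ⟨
    mirror (upper (p ∸ (p ∸ α)))          ≡⟨ cong (mirror ∘ upper) (ℕP.m∸[m∸n]≡n α≤p) ⟩
    mirror (upper α)                      ∎
    where open ≡-Reasoning

  upper≢p-⊞ : ∀ {α β} → α ℕ.≤ p → β ℕ.≤ p → α ≢ p → upper α ⊞ upper β ≼ upper (α *p β)
  upper≢p-⊞ {α} {β} α≤p β≤p α≢p = begin
    upper α ⊞ upper β   ≡⟨ cong (_⊞ upper β) (upper-≢p α≢p) ⟩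
    axis n-1 ⊞ upper β  ≲⟨ ⊞-monoʳ (axis n-1) (upper≼n β) ⟩
    axis n-1 ⊞ nn       ≡⟨ ⊞-identityʳ (axis n-1) ⟩
    axis n-1            ≡⟨ upper-≢p αβ≢p ⟨
    upper (α *p β)      ∎
    where open ≼-Reasoning
          αβ≢p : α *p β ≢ p
          αβ≢p e = α≢p (ℕP.≤-antisym α≤p (subst (ℕ._≤ α) e (*p≤ˡ α β≤p)))

  upper-⊞ : ∀ {α β} → α ℕ.≤ p → β ℕ.≤ p → upper α ⊞ upper β ≼ upper (α *p β)
  upper-⊞ {α} {β} α≤p β≤p = go (α ℕ.≟ p) (β ℕ.≟ p)
    where
      go : Dec (α ≡ p) → Dec (β ≡ p) → upper α ⊞ upper β ≼ upper (α *p β)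
      go (yes α≡p) (yes β≡p) = begin
        upper α ⊞ upper β ≡⟨ cong₂ _⊞_ (upper-≡p α≡p) (upper-≡p β≡p) ⟩
        nn ⊞ nn           ≡⟨ ⊞-identityˡ nn ⟩
        nn                ≡⟨ upper-≡p (trans (cong₂ _*p_ α≡p β≡p) (*p-identityˡ p)) ⟨
        upper (α *p β)    ∎
        where open ≼-Reasoning
      go (no α≢p) _        = upper≢p-⊞ α≤p β≤p α≢p
      go (yes _) (no β≢p) =
        subst₂ _≼_ (⊞-comm (upper β) (upper α)) (cong upper (*p-comm β α)) (upper≢p-⊞ β≤p α≤p β≢p)

  lower-⊞ : ∀ δ {w γ} → w ≼ upper γ → lower δ ⊞ w ≼ lower (δ *p γ)
  lower-⊞ δ {w} {γ} w≼upper = go δ (δ *p γ) refl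
    where
      open ≼-Reasoning
      w≼n : w ≼ nn
      w≼n = ≼-trans w≼upper (upper≼n γ)
      go : ∀ d e → d *p γ ≡ e → lower d ⊞ w ≼ lower e
      go d (suc _) _ = begin
        lower d ⊞ w   ≲⟨ ⊞-mono (lower≼0 d) w≼n ⟩
        axis 0ℤ ⊞ nn  ≡⟨ ⊞-identityʳ (axis 0ℤ) ⟩
        axis 0ℤ       ∎
      go zero zero _ = begin
        axis -1ℤ ⊞ w  ≲⟨ ⊞-monoʳ (axis -1ℤ) w≼n ⟩
        axis -1ℤ ⊞ nn ≡⟨ ⊞-identityʳ (axis -1ℤ) ⟩
        axis -1ℤ      ∎
      go (suc d) zero dγ≡0 = begin
        axis 0ℤ ⊞ w        ≲⟨ ⊞-monoʳ (axis 0ℤ) (subst (w ≼_) (upper-≢p γ≢p) w≼upper) ⟩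
        axis 0ℤ ⊞ axis n-1 ≡⟨ 0⊞n-1 ⟩
        axis -1ℤ           ∎
        where γ≢p : γ ≢ p
              γ≢p refl = case (trans (sym (*p-identityʳ (suc d))) dγ≡0) of λ ()

  -- The transformed algebra

  InB : Raw → Set
  InB (u , α) = α ℕ.≤ p × lower α ≼ u × u ≼ upper α

  infix 4 _≤ᴮ_
  infixl 7 _⊙ᴮ_ _∧ᴮ_
  infixl 6 _∨ᴮ_

  _≤ᴮ_ : Raw → Raw → Set
  _≤ᴮ_ = Pointwise _≼_ ℕ._≤_

  _⊙ᴮ_ : Raw → Raw → Raw
  (u , α) ⊙ᴮ (v , β) = (maxL (lower (α *p β)) (u ⊞ v) , α *p β)

  ∼ᴮ : Raw → Raw
  ∼ᴮ (u , α) = (mirror u , p ∸ α)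

  _∧ᴮ_ _∨ᴮ_ : Raw → Raw → Raw
  (u , α) ∧ᴮ (v , β) = (minL u v , α ℕ.⊓ β)
  (u , α) ∨ᴮ (v , β) = (maxL u v , α ℕ.⊔ β)

  ⊥ᴮ : Raw
  ⊥ᴮ = (axis -1ℤ , 0)

  InB-⊙ᴮ : ∀ q r → InB q → InB r → InB (q ⊙ᴮ r)
  InB-⊙ᴮ (u , α) (v , β) (α≤p , _ , u≼upper) (β≤p , _ , v≼upper) =
    *p≤p α≤p β≤p ,
    x≤x⊔y (lower (α *p β)) (u ⊞ v) ,
    ⊔-lub (lower≼upper (α *p β)) (≼-trans (⊞-mono u≼upper v≼upper) (upper-⊞ α≤p β≤p))

  InB-∼ᴮ : ∀ q → InB q → InB (∼ᴮ q)
  InB-∼ᴮ (u , α) (α≤p , lower≼u , u≼upper) =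
    ℕP.m∸n≤m p α ,
    subst (_≼ mirror u) (sym (lower-complement α≤p)) (mirror-antitone u≼upper) ,
    subst (mirror u ≼_) (sym (upper-complement α≤p)) (mirror-antitone lower≼u)

  InB-∧ᴮ : ∀ q r → InB q → InB r → InB (q ∧ᴮ r)
  InB-∧ᴮ (u , α) (v , β) (α≤p , lower≼u , u≼upper) (_ , lower≼v , v≼upper) =
    ℕP.≤-trans (ℕP.m⊓n≤m α β) α≤p ,
    ⊓-glb (≼-trans (lower-mono (ℕP.m⊓n≤m α β)) lower≼u) (≼-trans (lower-mono (ℕP.m⊓n≤n α β)) lower≼v) ,
    [ (λ e → subst (λ γ → minL u v ≼ upper γ) (sym e) (≼-trans (x⊓y≤x u v) u≼upper))
    , (λ e → subst (λ γ → minL u v ≼ upper γ) (sym e) (≼-trans (x⊓y≤y u v) v≼upper)) ]′ (ℕP.⊓-sel α β)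

  InB-∨ᴮ : ∀ q r → InB q → InB r → InB (q ∨ᴮ r)
  InB-∨ᴮ (u , α) (v , β) (α≤p , lower≼u , u≼upper) (β≤p , lower≼v , v≼upper) =
    ℕP.⊔-lub α≤p β≤p ,
    [ (λ e → subst (λ γ → lower γ ≼ maxL u v) (sym e) (≼-trans lower≼u (x≤x⊔y u v)))
    , (λ e → subst (λ γ → lower γ ≼ maxL u v) (sym e) (≼-trans lower≼v (x≤y⊔x u v))) ]′ (ℕP.⊔-sel α β) ,
    ⊔-lub (≼-trans u≼upper (upper-mono (ℕP.m≤m⊔n α β) αβ≤p))
          (≼-trans v≼upper (upper-mono (ℕP.m≤n⊔m α β) αβ≤p))
    where αβ≤p : α ℕ.⊔ β ℕ.≤ p
          αβ≤p = ℕP.⊔-lub α≤p β≤p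

  ⊙ᴮ-comm : ∀ q r → q ⊙ᴮ r ≡ r ⊙ᴮ q
  ⊙ᴮ-comm (u , α) (v , β) = cong₂ _,_ (cong₂ maxL (cong lower (*p-comm α β)) (⊞-comm u v)) (*p-comm α β)

  ⊙ᴮ-identityˡ : ∀ q → InB q → ⊤A ⊙ᴮ q ≡ q
  ⊙ᴮ-identityˡ (u , α) (_ , lower≼u , _) =
    cong₂ _,_ (trans (cong₂ maxL (cong lower (*p-identityˡ α)) (⊞-identityˡ u)) (maxL-≼ lower≼u))
              (*p-identityˡ α)

  truncate-⊞ˡ : ∀ δ x {w γ} → w ≼ upper γ →
                maxL (lower (δ *p γ)) (maxL (lower δ) x ⊞ w) ≡ maxL (lower (δ *p γ)) (x ⊞ w)
  truncate-⊞ˡ δ x {w} {γ} w≼upper = begin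
    maxL (lower (δ *p γ)) (maxL (lower δ) x ⊞ w)
      ≡⟨ cong (maxL (lower (δ *p γ))) (mono-≤-distrib-⊔ (cong (_⊞ w)) (⊞-monoˡ w) (lower δ) x) ⟩
    maxL (lower (δ *p γ)) (maxL (lower δ ⊞ w) (x ⊞ w))
      ≡⟨ maxL-absorb (x ⊞ w) (lower-⊞ δ w≼upper) ⟩
    maxL (lower (δ *p γ)) (x ⊞ w) ∎
    where open ≡-Reasoning

  truncate-⊞ʳ : ∀ δ x {w γ} → w ≼ upper γ →
                maxL (lower (γ *p δ)) (w ⊞ maxL (lower δ) x) ≡ maxL (lower (γ *p δ)) (w ⊞ x)
  truncate-⊞ʳ δ x {w} {γ} w≼upper =
    subst₂ (λ s t → maxL (lower s) t ≡ maxL (lower s) (w ⊞ x))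
           (*p-comm δ γ) (⊞-comm (maxL (lower δ) x) w)
           (trans (truncate-⊞ˡ δ x w≼upper) (cong (maxL (lower (δ *p γ))) (⊞-comm x w)))

  ⊙ᴮ-assoc : ∀ q r s → InB q → InB r → InB s → (q ⊙ᴮ r) ⊙ᴮ s ≡ q ⊙ᴮ (r ⊙ᴮ s)
  ⊙ᴮ-assoc (u , α) (v , β) (w , γ) (α≤p , _ , u≼upper) _ (γ≤p , _ , w≼upper) = cong₂ _,_ (begin
    maxL (lower ((α *p β) *p γ)) (maxL (lower (α *p β)) (u ⊞ v) ⊞ w)
      ≡⟨ truncate-⊞ˡ (α *p β) (u ⊞ v) w≼upper ⟩
    maxL (lower ((α *p β) *p γ)) (u ⊞ v ⊞ w)
      ≡⟨ cong₂ maxL (cong lower δ-assoc) (⊞-assoc u v w) ⟩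
    maxL (lower (α *p (β *p γ))) (u ⊞ (v ⊞ w))
      ≡⟨ truncate-⊞ʳ (β *p γ) (v ⊞ w) u≼upper ⟨
    maxL (lower (α *p (β *p γ))) (u ⊞ maxL (lower (β *p γ)) (v ⊞ w)) ∎) δ-assoc
    where open ≡-Reasoning
          δ-assoc : (α *p β) *p γ ≡ α *p (β *p γ)
          δ-assoc = *p-assoc α β γ α≤p γ≤p

  ∼ᴮ-involutive : ∀ q → InB q → ∼ᴮ (∼ᴮ q) ≡ q
  ∼ᴮ-involutive (u , α) (α≤p , _) = cong₂ _,_ (mirror-involutive u) (ℕP.m∸[m∸n]≡n α≤p)

  ≤ᴮ⇒⊙ᴮ∼ᴮ≡⊥ᴮ : ∀ u v {α β} → β ℕ.≤ p → (u , α) ≤ᴮ (v , β) → (u , α) ⊙ᴮ ∼ᴮ (v , β) ≡ ⊥ᴮ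
  ≤ᴮ⇒⊙ᴮ∼ᴮ≡⊥ᴮ u v {α} {β} β≤p (u≼v , α≤β) =
    cong₂ _,_ (trans (cong (λ γ → maxL (lower γ) (u ⊞ mirror v)) α*p[p∸β]≡0) (maxL-≽ (≼⇒⊞mirror≼-1 u≼v)))
              α*p[p∸β]≡0
    where α*p[p∸β]≡0 : α *p (p ∸ β) ≡ 0
          α*p[p∸β]≡0 = trans (*p-complement α β≤p) (ℕP.m≤n⇒m∸n≡0 α≤β)

  ⊙ᴮ∼ᴮ≡⊥ᴮ⇒≤ᴮ : ∀ u v {α β} → β ℕ.≤ p → (u , α) ⊙ᴮ ∼ᴮ (v , β) ≡ ⊥ᴮ → (u , α) ≤ᴮ (v , β)
  ⊙ᴮ∼ᴮ≡⊥ᴮ⇒≤ᴮ u v {α} {β} β≤p e =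
    ⊞mirror≼-1⇒≼ (subst (u ⊞ mirror v ≼_) (cong proj₁ e) (x≤y⊔x (lower (α *p (p ∸ β))) (u ⊞ mirror v))) ,
    ℕP.m∸n≡0⇒m≤n (trans (sym (*p-complement α β≤p)) (cong proj₂ e))

  ≤ᴮ-refl : Reflexive _≤ᴮ_
  ≤ᴮ-refl = ≼-refl , ℕP.≤-refl

  ≤ᴮ-trans : Transitive _≤ᴮ_
  ≤ᴮ-trans (u≼v , α≤β) (v≼w , β≤γ) = ≼-trans u≼v v≼w , ℕP.≤-trans α≤β β≤γ

  ≤ᴮ-antisym : Antisymmetric _≡_ _≤ᴮ_
  ≤ᴮ-antisym (u≼v , α≤β) (v≼u , β≤α) = cong₂ _,_ (≼-antisym u≼v v≼u) (ℕP.≤-antisym α≤β β≤α)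

  ∧ᴮ-lower : ∀ q r → q ∧ᴮ r ≤ᴮ q × q ∧ᴮ r ≤ᴮ r
  ∧ᴮ-lower (u , α) (v , β) = (x⊓y≤x u v , ℕP.m⊓n≤m α β) , (x⊓y≤y u v , ℕP.m⊓n≤n α β)

  ∧ᴮ-greatest : ∀ {q r s} → s ≤ᴮ q → s ≤ᴮ r → s ≤ᴮ q ∧ᴮ r
  ∧ᴮ-greatest (w≼u , γ≤α) (w≼v , γ≤β) = ⊓-glb w≼u w≼v , ℕP.⊓-glb γ≤α γ≤β

  ∨ᴮ-upper : ∀ q r → q ≤ᴮ q ∨ᴮ r × r ≤ᴮ q ∨ᴮ r
  ∨ᴮ-upper (u , α) (v , β) = (x≤x⊔y u v , ℕP.m≤m⊔n α β) , (x≤y⊔x u v , ℕP.m≤n⊔m α β)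

  ∨ᴮ-least : ∀ {q r s} → q ≤ᴮ s → r ≤ᴮ s → q ∨ᴮ r ≤ᴮ s
  ∨ᴮ-least (u≼w , α≤γ) (v≼w , β≤γ) = ⊔-lub u≼w v≼w , ℕP.⊔-lub α≤γ β≤γ

  ∧ᴮ-distribˡ-∨ᴮ : ∀ q r s → q ∧ᴮ (r ∨ᴮ s) ≡ (q ∧ᴮ r) ∨ᴮ (q ∧ᴮ s)
  ∧ᴮ-distribˡ-∨ᴮ (u , α) (v , β) (w , γ) = cong₂ _,_ (⊓-distribˡ-⊔ u v w) (ℕP.⊓-distribˡ-⊔ α β γ)

  ⊥ᴮ-least : ∀ q → InB q → ⊥ᴮ ≤ᴮ q
  ⊥ᴮ-least (u , α) (_ , lower≼u , _) = ≼-trans (-1≼lower α) lower≼u , z≤n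

  ⊤ᴮ-greatest : ∀ q → InB q → q ≤ᴮ ⊤A
  ⊤ᴮ-greatest (u , α) (α≤p , _ , u≼upper) = ≼-trans u≼upper (upper≼n α) , α≤p

  -- The change of coordinates

  φ : Raw → Raw
  φ (x , zero)  = (mirror x , zero)
  φ (x , suc α) = (x , suc α)

  φ-involutive : ∀ a → φ (φ a) ≡ a
  φ-involutive (x , zero)  = cong (_, 0) (mirror-involutive x)
  φ-involutive (x , suc α) = refl

  φ-injective : ∀ {a b} → φ a ≡ φ b → a ≡ b
  φ-injective {a} {b} e = trans (sym (φ-involutive a)) (trans (cong φ e) (φ-involutive b))

  φ-pos : ∀ x {α} → 0 < α → φ (x , α) ≡ (x , α)
  φ-pos x {suc _} _ = refl

  φ-⊥ : φ ⊥A ≡ ⊥ᴮ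
  φ-⊥ = cong (_, 0) mirror-n

  φ-⊤ : φ ⊤A ≡ ⊤A
  φ-⊤ = φ-pos nn p>0

  φ-∼ : ∀ a → proj₂ a ℕ.≤ p → φ (∼ a) ≡ ∼ᴮ (φ a)
  φ-∼ (x , α) α≤p with α ℕ.≟ 0 | α ℕ.≟ p
  ... | yes refl | _       = trans (φ-pos x p>0) (cong (_, p) (sym (mirror-involutive x)))
  ... | no _     | yes refl = begin
    φ (x , p ∸ p)   ≡⟨ cong (λ γ → φ (x , γ)) (ℕP.n∸n≡0 p) ⟩
    (mirror x , 0)   ≡⟨ cong (mirror x ,_) (ℕP.n∸n≡0 p) ⟨
    ∼ᴮ (x , p)      ≡⟨ cong ∼ᴮ (φ-pos x p>0) ⟨
    ∼ᴮ (φ (x , p))  ∎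
    where open ≡-Reasoning
  ... | no α≢0   | no α≢p  = trans (φ-pos _ (ℕP.m<n⇒0<n∸m (ℕP.≤∧≢⇒< α≤p α≢p)))
                                   (cong ∼ᴮ (sym (φ-pos x (ℕP.n≢0⇒n>0 α≢0))))

  φ-⊙-weight0 : ∀ {t s γ} → γ ≡ 0 → mirror t ≡ s → (mirror (minL nn t) , 0) ≡ (maxL (lower γ) s , γ)
  φ-⊙-weight0 {t} refl refl = cong (_, 0) (mirror-minL-n t)

  φ-⊙ : ∀ a b → proj₂ a ℕ.≤ p → proj₂ b ℕ.≤ p → φ (a ⊙ b) ≡ φ a ⊙ᴮ φ b
  φ-⊙ ((m , r) , suc α) ((k , s) , suc β) _ _ with suc α *p suc β
  ... | zero  = φ-⊙-weight0 refl (cong₂ _,_ (N-1-[2N-[m+k+1]]≡m+k-N N m k) (ℤP.neg-involutive (r + s)))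
    where N-1-[2N-[m+k+1]]≡m+k-N : ∀ N m k → (N - + 1) - (+ 2 * N - (m + k + + 1)) ≡ m + k - N
          N-1-[2N-[m+k+1]]≡m+k-N = solve-∀
  ... | suc _ = refl
  φ-⊙ ((m , r) , suc α) ((k , s) , zero) α≤p _ =
    φ-⊙-weight0 (*p-zeroʳ α≤p) (cong₂ _,_ (N-1-[N-m+k]≡m+[N-1-k]-N N m k) (-[-r+s]≡r-s r s))
    where N-1-[N-m+k]≡m+[N-1-k]-N : ∀ N m k → (N - + 1) - (N - m + k) ≡ m + ((N - + 1) - k) - N
          N-1-[N-m+k]≡m+[N-1-k]-N = solve-∀
          -[-r+s]≡r-s : ∀ r s → - (- r + s) ≡ r - s
          -[-r+s]≡r-s = solve-∀
  φ-⊙ ((m , r) , zero) ((k , s) , suc β) _ β≤p =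
    φ-⊙-weight0 (*p-zeroˡ β≤p) (cong₂ _,_ (N-1-[N-k+m]≡N-1-m+k-N N m k) (-[-s+r]≡-r+s r s))
    where N-1-[N-k+m]≡N-1-m+k-N : ∀ N m k → (N - + 1) - (N - k + m) ≡ (N - + 1) - m + k - N
          N-1-[N-k+m]≡N-1-m+k-N = solve-∀
          -[-s+r]≡-r+s : ∀ r s → - (- s + r) ≡ - r + s
          -[-s+r]≡-r+s = solve-∀
  φ-⊙ ((m , r) , zero) ((k , s) , zero) _ _ =
    φ-⊙-weight0 (*p-zeroˡ z≤n) (cong₂ _,_ (N-1-[m+k+1]≡N-1-m+[N-1-k]-N N m k) (ℤP.neg-distrib-+ r s))
    where N-1-[m+k+1]≡N-1-m+[N-1-k]-N :
            ∀ N m k → (N - + 1) - (m + k + + 1) ≡ (N - + 1) - m + ((N - + 1) - k) - N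
          N-1-[m+k+1]≡N-1-m+[N-1-k]-N = solve-∀

  ⊑⇒≤ᴮ : ∀ {a b} → a ⊑ b → φ a ≤ᴮ φ b
  ⊑⇒≤ᴮ (o1 {α = suc _} {β = suc _} _ α≤β x≼y) = x≼y , α≤β
  ⊑⇒≤ᴮ (o1 {α = suc _} {β = zero} _ () _)
  ⊑⇒≤ᴮ (o2 y≼x)                               = mirror-antitone y≼x , z≤n
  ⊑⇒≤ᴮ (o3 {β = suc _} _ n-1≼+)               = n-1≼+⇒mirror≼ n-1≼+ , z≤n
  ⊑⇒≤ᴮ (o3 {β = zero} () _)

  ≤ᴮ⇒⊑ : ∀ {a b} → φ a ≤ᴮ φ b → a ⊑ b
  ≤ᴮ⇒⊑ {x , zero}  {y , zero}  (h , _)     = o2 (mirror-reflects h)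
  ≤ᴮ⇒⊑ {x , zero}  {y , suc _} (h , _)     = o3 (s≤s z≤n) (mirror≼⇒n-1≼+ h)
  ≤ᴮ⇒⊑ {x , suc _} {y , zero}  (_ , ())
  ≤ᴮ⇒⊑ {x , suc _} {y , suc _} (x≼y , α≤β) = o1 (s≤s z≤n) α≤β x≼y

  ≤ᴮ⇒φ⊑ : ∀ {q b} → q ≤ᴮ φ b → φ q ⊑ b
  ≤ᴮ⇒φ⊑ {q} h = ≤ᴮ⇒⊑ (subst (_≤ᴮ _) (sym (φ-involutive q)) h)

  ≤ᴮ⇒⊑φ : ∀ {a q} → φ a ≤ᴮ q → a ⊑ φ q
  ≤ᴮ⇒⊑φ {q = q} h = ≤ᴮ⇒⊑ (subst (_ ≤ᴮ_) (sym (φ-involutive q)) h)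

  InA⇒≤p : ∀ {a} → InA a → proj₂ a ℕ.≤ p
  InA⇒≤p (end0 _)       = z≤n
  InA⇒≤p (endp _)       = ℕP.≤-refl
  InA⇒≤p (mid _ α<p _) = ℕP.<⇒≤ α<p

  InA⇒InB : ∀ {a} → InA a → InB (φ a)
  InA⇒InB (end0 {x} (0≼x , x≼n)) =
    z≤n ,
    subst (_≼ mirror x) mirror-n (mirror-antitone x≼n) ,
    subst (mirror x ≼_) (trans mirror-0 (sym upper-0)) (mirror-antitone 0≼x)
  InA⇒InB (endp {x} (0≼x , x≼n)) = subst InB (sym (φ-pos x p>0))
    (ℕP.≤-refl , subst (_≼ x) (sym (lower-pos p>0)) 0≼x , subst (x ≼_) (sym upper-p) x≼n)
  InA⇒InB (mid {x} 0<α α<p (0≼x , x≼n-1)) = subst InB (sym (φ-pos x 0<α))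
    (ℕP.<⇒≤ α<p , subst (_≼ x) (sym (lower-pos 0<α)) 0≼x , subst (x ≼_) (sym (upper-≢p (ℕP.<⇒≢ α<p))) x≼n-1)

  InB⇒InA : ∀ {a} → InB (φ a) → InA a
  InB⇒InA {x , zero} (_ , -1≼mx , mx≼upper) =
    end0 (mirror-reflects (subst (mirror x ≼_) (trans upper-0 (sym mirror-0)) mx≼upper) ,
          mirror-reflects (subst (_≼ mirror x) (sym mirror-n) -1≼mx))
  InB⇒InA {x , suc α} (α<p , 0≼x , x≼upper) = case suc α ℕ.≟ p of λ where
    (yes α+1≡p) → subst (λ γ → InA (x , γ)) (sym α+1≡p) (endp (0≼x , subst (x ≼_) (upper-≡p α+1≡p) x≼upper))
    (no α+1≢p)  → mid (s≤s z≤n) (ℕP.≤∧≢⇒< α<p α+1≢p) (0≼x , subst (x ≼_) (upper-≢p α+1≢p) x≼upper)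

  -- The algebra A

  InA-⊙ : ∀ a b → InA a → InA b → InA (a ⊙ b)
  InA-⊙ a b a∈A b∈A = InB⇒InA (subst InB (sym (φ-⊙ a b (InA⇒≤p a∈A) (InA⇒≤p b∈A)))
                                        (InB-⊙ᴮ (φ a) (φ b) (InA⇒InB a∈A) (InA⇒InB b∈A)))

  InA-∼ : ∀ a → InA a → InA (∼ a)
  InA-∼ a a∈A = InB⇒InA (subst InB (sym (φ-∼ a (InA⇒≤p a∈A))) (InB-∼ᴮ (φ a) (InA⇒InB a∈A)))

  InA-⊸ : ∀ a b → InA a → InA b → InA (a ⊸ b)
  InA-⊸ a b a∈A b∈A = InA-∼ (a ⊙ ∼ b) (InA-⊙ a (∼ b) a∈A (InA-∼ b b∈A))

  InA-⊤ : InA ⊤A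
  InA-⊤ = endp (0≼n , ≼-refl)

  InA-⊥ : InA ⊥A
  InA-⊥ = end0 (0≼n , ≼-refl)

  φ-⊙-InA : ∀ {a b} → InA a → InA b → φ (a ⊙ b) ≡ φ a ⊙ᴮ φ b
  φ-⊙-InA {a} {b} a∈A b∈A = φ-⊙ a b (InA⇒≤p a∈A) (InA⇒≤p b∈A)

  ⊙-assoc : ∀ a b c → InA a → InA b → InA c → (a ⊙ b) ⊙ c ≡ a ⊙ (b ⊙ c)
  ⊙-assoc a b c a∈A b∈A c∈A = φ-injective (begin
    φ ((a ⊙ b) ⊙ c)     ≡⟨ φ-⊙-InA (InA-⊙ a b a∈A b∈A) c∈A ⟩
    φ (a ⊙ b) ⊙ᴮ φ c    ≡⟨ cong (_⊙ᴮ φ c) (φ-⊙-InA a∈A b∈A) ⟩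
    φ a ⊙ᴮ φ b ⊙ᴮ φ c   ≡⟨ ⊙ᴮ-assoc (φ a) (φ b) (φ c) (InA⇒InB a∈A) (InA⇒InB b∈A) (InA⇒InB c∈A) ⟩
    φ a ⊙ᴮ (φ b ⊙ᴮ φ c) ≡⟨ cong (φ a ⊙ᴮ_) (φ-⊙-InA b∈A c∈A) ⟨
    φ a ⊙ᴮ φ (b ⊙ c)    ≡⟨ φ-⊙-InA a∈A (InA-⊙ b c b∈A c∈A) ⟨
    φ (a ⊙ (b ⊙ c))     ∎)
    where open ≡-Reasoning

  ⊙-comm : ∀ a b → InA a → InA b → a ⊙ b ≡ b ⊙ a
  ⊙-comm a b a∈A b∈A = φ-injective (begin
    φ (a ⊙ b)   ≡⟨ φ-⊙-InA a∈A b∈A ⟩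
    φ a ⊙ᴮ φ b  ≡⟨ ⊙ᴮ-comm (φ a) (φ b) ⟩
    φ b ⊙ᴮ φ a  ≡⟨ φ-⊙-InA b∈A a∈A ⟨
    φ (b ⊙ a)   ∎)
    where open ≡-Reasoning

  ⊙-identityˡ : ∀ a → InA a → ⊤A ⊙ a ≡ a
  ⊙-identityˡ a a∈A = φ-injective (begin
    φ (⊤A ⊙ a)   ≡⟨ φ-⊙-InA InA-⊤ a∈A ⟩
    φ ⊤A ⊙ᴮ φ a  ≡⟨ cong (_⊙ᴮ φ a) φ-⊤ ⟩
    ⊤A ⊙ᴮ φ a    ≡⟨ ⊙ᴮ-identityˡ (φ a) (InA⇒InB a∈A) ⟩
    φ a          ∎)
    where open ≡-Reasoning

  ∼-involutive : ∀ a → InA a → ∼ (∼ a) ≡ a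
  ∼-involutive a a∈A = φ-injective (begin
    φ (∼ (∼ a))   ≡⟨ φ-∼ (∼ a) (InA⇒≤p (InA-∼ a a∈A)) ⟩
    ∼ᴮ (φ (∼ a))  ≡⟨ cong ∼ᴮ (φ-∼ a (InA⇒≤p a∈A)) ⟩
    ∼ᴮ (∼ᴮ (φ a)) ≡⟨ ∼ᴮ-involutive (φ a) (InA⇒InB a∈A) ⟩
    φ a           ∎)
    where open ≡-Reasoning

  ⊑-refl : ∀ a → a ⊑ a
  ⊑-refl a = ≤ᴮ⇒⊑ ≤ᴮ-refl

  ⊑-antisym : ∀ {a b} → a ⊑ b → b ⊑ a → a ≡ b
  ⊑-antisym a⊑b b⊑a = φ-injective (≤ᴮ-antisym (⊑⇒≤ᴮ a⊑b) (⊑⇒≤ᴮ b⊑a))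

  ⊑-trans : ∀ {a b c} → a ⊑ b → b ⊑ c → a ⊑ c
  ⊑-trans a⊑b b⊑c = ≤ᴮ⇒⊑ (≤ᴮ-trans (⊑⇒≤ᴮ a⊑b) (⊑⇒≤ᴮ b⊑c))

  infixl 22 _∧_
  infixl 21 _∨_

  _∧_ _∨_ : Raw → Raw → Raw
  a ∧ b = φ (φ a ∧ᴮ φ b)
  a ∨ b = φ (φ a ∨ᴮ φ b)

  InA-∧ : ∀ a b → InA a → InA b → InA (a ∧ b)
  InA-∧ a b a∈A b∈A =
    InB⇒InA (subst InB (sym (φ-involutive _)) (InB-∧ᴮ (φ a) (φ b) (InA⇒InB a∈A) (InA⇒InB b∈A)))

  InA-∨ : ∀ a b → InA a → InA b → InA (a ∨ b)
  InA-∨ a b a∈A b∈A =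
    InB⇒InA (subst InB (sym (φ-involutive _)) (InB-∨ᴮ (φ a) (φ b) (InA⇒InB a∈A) (InA⇒InB b∈A)))

  ∧-lower : ∀ a b → a ∧ b ⊑ a × a ∧ b ⊑ b
  ∧-lower a b = ≤ᴮ⇒φ⊑ (proj₁ (∧ᴮ-lower (φ a) (φ b))) , ≤ᴮ⇒φ⊑ (proj₂ (∧ᴮ-lower (φ a) (φ b)))

  ∧-greatest : ∀ {a b c} → c ⊑ a → c ⊑ b → c ⊑ a ∧ b
  ∧-greatest c⊑a c⊑b = ≤ᴮ⇒⊑φ (∧ᴮ-greatest (⊑⇒≤ᴮ c⊑a) (⊑⇒≤ᴮ c⊑b))

  ∨-upper : ∀ a b → a ⊑ a ∨ b × b ⊑ a ∨ b
  ∨-upper a b = ≤ᴮ⇒⊑φ (proj₁ (∨ᴮ-upper (φ a) (φ b))) , ≤ᴮ⇒⊑φ (proj₂ (∨ᴮ-upper (φ a) (φ b)))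

  ∨-least : ∀ {a b c} → a ⊑ c → b ⊑ c → a ∨ b ⊑ c
  ∨-least a⊑c b⊑c = ≤ᴮ⇒φ⊑ (∨ᴮ-least (⊑⇒≤ᴮ a⊑c) (⊑⇒≤ᴮ b⊑c))

  ∧-distribˡ-∨ : ∀ a b c → a ∧ (b ∨ c) ≡ a ∧ b ∨ a ∧ c
  ∧-distribˡ-∨ a b c = begin
    φ (φ a ∧ᴮ φ (b ∨ c))            ≡⟨ cong (λ t → φ (φ a ∧ᴮ t)) (φ-involutive (φ b ∨ᴮ φ c)) ⟩
    φ (φ a ∧ᴮ (φ b ∨ᴮ φ c))         ≡⟨ cong φ (∧ᴮ-distribˡ-∨ᴮ (φ a) (φ b) (φ c)) ⟩
    φ (φ a ∧ᴮ φ b ∨ᴮ φ a ∧ᴮ φ c)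
      ≡⟨ cong₂ (λ s t → φ (s ∨ᴮ t)) (φ-involutive (φ a ∧ᴮ φ b)) (φ-involutive (φ a ∧ᴮ φ c)) ⟨
    φ (φ (a ∧ b) ∨ᴮ φ (a ∧ c))      ∎
    where open ≡-Reasoning

  ⊥-least : ∀ a → InA a → ⊥A ⊑ a
  ⊥-least a a∈A = ≤ᴮ⇒⊑ (subst (_≤ᴮ φ a) (sym φ-⊥) (⊥ᴮ-least (φ a) (InA⇒InB a∈A)))

  ⊤-greatest : ∀ a → InA a → a ⊑ ⊤A
  ⊤-greatest a a∈A = ≤ᴮ⇒⊑ (subst (φ a ≤ᴮ_) (sym φ-⊤) (⊤ᴮ-greatest (φ a) (InA⇒InB a∈A)))

  φ-⊙∼ : ∀ {a b} → InA a → InA b → φ (a ⊙ ∼ b) ≡ φ a ⊙ᴮ ∼ᴮ (φ b)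
  φ-⊙∼ {a} {b} a∈A b∈A = trans (φ-⊙-InA a∈A (InA-∼ b b∈A)) (cong (φ a ⊙ᴮ_) (φ-∼ b (InA⇒≤p b∈A)))

  ⊑⇒⊙∼≡⊥ : ∀ {a b} → InA a → InA b → a ⊑ b → a ⊙ ∼ b ≡ ⊥A
  ⊑⇒⊙∼≡⊥ {a} {b} a∈A b∈A a⊑b = φ-injective (begin
    φ (a ⊙ ∼ b)       ≡⟨ φ-⊙∼ a∈A b∈A ⟩
    φ a ⊙ᴮ ∼ᴮ (φ b)   ≡⟨ ≤ᴮ⇒⊙ᴮ∼ᴮ≡⊥ᴮ (proj₁ (φ a)) (proj₁ (φ b)) (proj₁ (InA⇒InB b∈A)) (⊑⇒≤ᴮ a⊑b) ⟩
    ⊥ᴮ                ≡⟨ φ-⊥ ⟨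
    φ ⊥A              ∎)
    where open ≡-Reasoning

  ⊙∼≡⊥⇒⊑ : ∀ {a b} → InA a → InA b → a ⊙ ∼ b ≡ ⊥A → a ⊑ b
  ⊙∼≡⊥⇒⊑ {a} {b} a∈A b∈A e = ≤ᴮ⇒⊑ (⊙ᴮ∼ᴮ≡⊥ᴮ⇒≤ᴮ (proj₁ (φ a)) (proj₁ (φ b)) (proj₁ (InA⇒InB b∈A))
    (trans (sym (φ-⊙∼ a∈A b∈A)) (trans (cong φ e) φ-⊥)))

  ⊙∼-⊸ : ∀ a b c → InA a → InA b → InA c → (a ⊙ b) ⊙ ∼ c ≡ a ⊙ ∼ (b ⊸ c)
  ⊙∼-⊸ a b c a∈A b∈A c∈A = begin
    (a ⊙ b) ⊙ ∼ c          ≡⟨ ⊙-assoc a b (∼ c) a∈A b∈A (InA-∼ c c∈A) ⟩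
    a ⊙ (b ⊙ ∼ c)          ≡⟨ cong (a ⊙_) (∼-involutive (b ⊙ ∼ c) (InA-⊙ b (∼ c) b∈A (InA-∼ c c∈A))) ⟨
    a ⊙ ∼ (∼ (b ⊙ ∼ c))    ∎
    where open ≡-Reasoning

  residuation : ∀ a b c → InA a → InA b → InA c →
                ((a ⊙ b) ⊑ c → a ⊑ (b ⊸ c)) × (a ⊑ (b ⊸ c) → (a ⊙ b) ⊑ c)
  residuation a b c a∈A b∈A c∈A =
    (λ a⊙b⊑c → ⊙∼≡⊥⇒⊑ a∈A b⊸c∈A (trans (sym (⊙∼-⊸ a b c a∈A b∈A c∈A)) (⊑⇒⊙∼≡⊥ a⊙b∈A c∈A a⊙b⊑c))) ,
    (λ a⊑b⊸c → ⊙∼≡⊥⇒⊑ a⊙b∈A c∈A (trans (⊙∼-⊸ a b c a∈A b∈A c∈A) (⊑⇒⊙∼≡⊥ a∈A b⊸c∈A a⊑b⊸c)))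
    where a⊙b∈A : InA (a ⊙ b)
          a⊙b∈A = InA-⊙ a b a∈A b∈A
          b⊸c∈A : InA (b ⊸ c)
          b⊸c∈A = InA-⊸ b c b∈A c∈A

  ⊸⊥≡∼ : ∀ a → InA a → a ⊸ ⊥A ≡ ∼ a
  ⊸⊥≡∼ a a∈A = cong ∼ (trans (⊙-comm a ⊤A a∈A InA-⊤) (⊙-identityˡ a a∈A))

  ⊸⊥-involutive : ∀ a → InA a → (a ⊸ ⊥A) ⊸ ⊥A ≡ a
  ⊸⊥-involutive a a∈A = begin
    (a ⊸ ⊥A) ⊸ ⊥A  ≡⟨ ⊸⊥≡∼ (a ⊸ ⊥A) (InA-⊸ a ⊥A a∈A InA-⊥) ⟩
    ∼ (a ⊸ ⊥A)     ≡⟨ cong ∼ (⊸⊥≡∼ a a∈A) ⟩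
    ∼ (∼ a)        ≡⟨ ∼-involutive a a∈A ⟩
    a              ∎
    where open ≡-Reasoning

theorem3p1 : (n p : ℕ) → 0 < n → 0 < p →
  let open Alg n p in
  -- A is closed under ⊙ and ⊸, and contains ⊤ and ⊥
  ((a b : Raw) → InA a → InA b → InA (a ⊙ b)) ×
  ((a b : Raw) → InA a → InA b → InA (a ⊸ b)) ×
  InA ⊤A × InA ⊥A ×
  -- ⟨A; ⊙, ⊤⟩ is a commutative monoid
  ((a b c : Raw) → InA a → InA b → InA c → (a ⊙ b) ⊙ c ≡ a ⊙ (b ⊙ c)) ×
  ((a b : Raw) → InA a → InA b → a ⊙ b ≡ b ⊙ a) ×
  ((a : Raw) → InA a → ⊤A ⊙ a ≡ a) ×
  -- ≤ is a partial order on A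
  ((a : Raw) → InA a → a ⊑ a) ×
  ((a b : Raw) → InA a → InA b → a ⊑ b → b ⊑ a → a ≡ b) ×
  ((a b c : Raw) → InA a → InA b → InA c → a ⊑ b → b ⊑ c → a ⊑ c) ×
  -- meets and joins exist (∧, ∨), and the lattice is distributive
  Σ (Raw → Raw → Raw) (λ meet → Σ (Raw → Raw → Raw) (λ join →
    ((a b : Raw) → InA a → InA b → InA (meet a b)) ×
    ((a b : Raw) → InA a → InA b → InA (join a b)) ×
    ((a b : Raw) → InA a → InA b → meet a b ⊑ a × meet a b ⊑ b) ×
    ((a b c : Raw) → InA a → InA b → InA c → c ⊑ a → c ⊑ b → c ⊑ meet a b) ×
    ((a b : Raw) → InA a → InA b → a ⊑ join a b × b ⊑ join a b) ×
    ((a b c : Raw) → InA a → InA b → InA c → a ⊑ c → b ⊑ c → join a b ⊑ c) ×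
    ((a b c : Raw) → InA a → InA b → InA c →
      meet a (join b c) ≡ join (meet a b) (meet a c)))) ×
  -- ⊥ is least and ⊤ is greatest
  ((a : Raw) → InA a → ⊥A ⊑ a × a ⊑ ⊤A) ×
  -- residuation
  ((a b c : Raw) → InA a → InA b → InA c →
    ((a ⊙ b) ⊑ c → a ⊑ (b ⊸ c)) × (a ⊑ (b ⊸ c) → (a ⊙ b) ⊑ c)) ×
  -- involutivity
  ((a : Raw) → InA a → (a ⊸ ⊥A) ⊸ ⊥A ≡ a)
theorem3p1 n p n>0 p>0 =
  InA-⊙ , InA-⊸ , InA-⊤ , InA-⊥ , ⊙-assoc , ⊙-comm , ⊙-identityˡ ,
  (λ a _ → ⊑-refl a) , (λ _ _ _ _ → ⊑-antisym) , (λ _ _ _ _ _ _ → ⊑-trans) ,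
  ( _∧_ , _∨_ , InA-∧ , InA-∨
  , (λ a b _ _ → ∧-lower a b) , (λ _ _ _ _ _ _ → ∧-greatest)
  , (λ a b _ _ → ∨-upper a b) , (λ _ _ _ _ _ _ → ∨-least)
  , (λ a b c _ _ _ → ∧-distribˡ-∨ a b c) ) ,
  (λ a a∈A → ⊥-least a a∈A , ⊤-greatest a a∈A) ,
  residuation ,
  ⊸⊥-involutive
  where open Model n p n>0 p>0
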